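{- Let $A$ be a $d\times n$ integer matrix of rank $d$ with $\ker(A)\cap\mathbb{R}^n_{\ge0}=\{\mathbf{0}\}$. Every external chamber of $A$ is simplicial.
   Context: $\operatorname{pos}_{\mathbb{R}}(\cdot)$ is the cone of nonnegative real combinations. A simplicial cone of $A$ is $\operatorname{pos}_{\mathbb{R}}(A_s)$ for a set $s$ of columns with $|s|=\operatorname{rank}(A_s)=d$. The chamber complex of $A$ is the fan formed by the cones $\bigcap\{\text{simplicial cones containing }\mathbf{b}\}$, $\mathbf{b}\in\operatorname{pos}_{\mathbb{R}}(A)$, with faces; its $d$-dimensional cones are chambers. A column $\mathbf{a}_j$ is external if it is not in the cone generated by the other columns. A chamber is external if all but exactly one of its rays are generated by external columns of $A$. A cone is simplicial if its ray generators are linearly independent.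
   Formalization: Vectors and cones (the chambers, their rays and faces) and the points b have rational coordinates, and the coefficients of nonnegative combinations, including those in the kernel condition, are rational rather than real. -}

module Defs where

open import Data.Nat using (ℕ; zero; suc)
open import Data.Fin using (Fin; zero; suc)
open import Data.Integer using (ℤ)
open import Data.Rational using (ℚ; 0ℚ; _+_; _*_; _≤_; _/_)
open import Data.Product using (Σ; ∃; _×_; _,_)
open import Data.Sum using (_⊎_)
open import Relation.Nullary using (¬_)
open import Relation.Binary.PropositionalEquality using (_≡_)
open import Function.Definitions using (Injective)

Vecℚ : ℕ → Set
Vecℚ d = Fin d → ℚ

Σℚ : ∀ {k} → (Fin k → ℚ) → ℚ
Σℚ {zero}  f = 0ℚ
Σℚ {suc k} f = f zero + Σℚ (λ l → f (suc l))

_≈v_ : ∀ {d} → Vecℚ d → Vecℚ d → Set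
u ≈v v = ∀ i → u i ≡ v i

zeroV : ∀ {d} → Vecℚ d
zeroV _ = 0ℚ

lincomb : ∀ {d k} → (Fin k → Vecℚ d) → (Fin k → ℚ) → Vecℚ d
lincomb g c i = Σℚ (λ l → c l * g l i)

LinIndep : ∀ {d k} → (Fin k → Vecℚ d) → Set
LinIndep g = ∀ c → lincomb g c ≈v zeroV → ∀ l → c l ≡ 0ℚ

Nonneg : ∀ {k} → (Fin k → ℚ) → Set
Nonneg c = ∀ l → 0ℚ ≤ c l

InPos : ∀ {d k} → (Fin k → Vecℚ d) → Vecℚ d → Set
InPos g b = Σ _ λ c → Nonneg c × (lincomb g c ≈v b)

Matrix : ℕ → ℕ → Set
Matrix d n = Fin d → Fin n → ℤ

col : ∀ {d n} → Matrix d n → Fin n → Vecℚ d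
col A j i = A i j / 1

-- rank(A) = d : some d columns are linearly independent
FullRank : ∀ {d n} → Matrix d n → Set
FullRank {d} {n} A = Σ (Fin d → Fin n) λ s → Injective _≡_ _≡_ s × LinIndep (λ l → col A (s l))

PointedKer : ∀ {d n} → Matrix d n → Set
PointedKer A = ∀ x → Nonneg x → lincomb (col A) x ≈v zeroV → ∀ j → x j ≡ 0ℚ

BasisSel : ∀ {d n} → Matrix d n → (Fin d → Fin n) → Set
BasisSel A s = Injective _≡_ _≡_ s × LinIndep (λ l → col A (s l))

Cone : ℕ → Set₁
Cone d = Vecℚ d → Set

-- σ(b) : intersection of all simplicial cones of A containing b
σ : ∀ {d n} → Matrix d n → Vecℚ d → Cone d
σ {d} {n} A b x = (s : Fin d → Fin n) → BasisSel A s →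
  InPos (λ l → col A (s l)) b → InPos (λ l → col A (s l)) x

FullDim : ∀ {d} → Cone d → Set
FullDim {d} C = Σ (Fin d → Vecℚ d) λ g → (∀ l → C (g l)) × LinIndep g

-- b ∈ pos(A) and σ(b) is d-dimensional, i.e. σ(b) is a chamber
IsChamber : ∀ {d n} → Matrix d n → Vecℚ d → Set
IsChamber A b = InPos (col A) b × FullDim (σ A b)

dot : ∀ {d} → Vecℚ d → Vecℚ d → ℚ
dot w x = Σℚ (λ i → w i * x i)

ray : ∀ {d} → Vecℚ d → Cone d
ray v x = Σ ℚ λ t → 0ℚ ≤ t × (∀ i → x i ≡ t * v i)

-- F is a face of C (cut out by a supporting hyperplane)
IsFace : ∀ {d} → Cone d → Cone d → Set
IsFace {d} C F = Σ (Vecℚ d) λ w →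
  (∀ x → C x → 0ℚ ≤ dot w x) ×
  (∀ x → F x → C x × dot w x ≡ 0ℚ) ×
  (∀ x → C x → dot w x ≡ 0ℚ → F x)

Nonzero : ∀ {d} → Vecℚ d → Set
Nonzero v = ¬ (v ≈v zeroV)

IsRay : ∀ {d} → Cone d → Vecℚ d → Set
IsRay C v = Nonzero v × IsFace C (ray v)

SameSet : ∀ {d} → Cone d → Cone d → Set
SameSet P Q = ∀ x → (P x → Q x) × (Q x → P x)

External : ∀ {d n} → Matrix d n → Fin n → Set
External A j = ¬ (Σ _ λ c → Nonneg c × c j ≡ 0ℚ × (lincomb (col A) c ≈v col A j))

GenByExternal : ∀ {d n} → Matrix d n → Vecℚ d → Set
GenByExternal A v = Σ _ λ j → External A j × SameSet (ray v) (ray (col A j))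

-- all but exactly one of the rays of C are generated by external columns
ExternalCone : ∀ {d n} → Matrix d n → Cone d → Set
ExternalCone {d} A C = Σ (Vecℚ d) λ v →
  IsRay C v × ¬ GenByExternal A v ×
  (∀ u → IsRay C u → SameSet (ray u) (ray v) ⊎ GenByExternal A u)

Simplicial : ∀ {d} → Cone d → Set
Simplicial {d} C = Σ ℕ λ k → Σ (Fin k → Vecℚ d) λ g →
  (∀ l → IsRay C (g l)) ×
  (∀ u → IsRay C u → Σ (Fin k) λ l → SameSet (ray u) (ray (g l))) ×
  LinIndep g

{-# OPTIONS --safe #-}
-- Choose a simplicial cone pos(a₁, …, a_d) of A containing b; the chamber C = σ(b) lies inside it.
-- Every column a_l lying in C is a ray of C, and an external column lying in C must be one of the
-- a_l, since otherwise it would be a nonnegative combination of the other columns. So the rays of C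
-- are the non-external ray v together with the external columns a_l in C. Writing v = Σ c_l a_l
-- with c ≥ 0, some l with c_l ≠ 0 is not such a column, for otherwise extremality of v would put
-- every a_l with c_l ≠ 0 on the ray of v. The coefficient c_l then separates v from the other
-- generators, which are part of the basis a, so the generators are linearly independent.
module Submission where

open import Defs
open import Algebra.Bundles using (CommutativeRing)
open import Data.Nat as ℕ using (ℕ; zero; suc; z≤n; s≤s)
open import Data.Nat.Properties as ℕP using ()
open import Data.Fin using (Fin; zero; suc; punchIn)
open import Data.Fin.Properties as FinP using (any?; all?; punchInᵢ≢i)
open import Data.Vec.Functional using (_∷_; insertAt)
open import Data.Vec.Functional.Properties using (insertAt-lookup; insertAt-punchIn)
open import Data.Rational as ℚ using (ℚ; 0ℚ; 1ℚ; _+_; _*_; -_; _-_; _≤_; 1/_)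
open import Data.Rational.Properties as ℚP using ()
open import Data.Rational.Solver using (module +-*-Solver)
open import Data.Product using (∃; ∃-syntax; _×_; _,_; proj₁; proj₂; map₂)
open import Data.Sum using (_⊎_; inj₁; inj₂)
open import Data.Empty using (⊥-elim)
open import Function.Base using (_∘_)
open import Function.Definitions using (Injective)
open import Relation.Nullary using (¬_; Dec; yes; no)
open import Relation.Nullary.Decidable using (¬?; _×-dec_; _→-dec_; map′; decidable-stable)
open import Relation.Binary.PropositionalEquality
open CommutativeRing ℚP.+-*-commutativeRing using (semiring)
open import Algebra.Properties.Semiring.Sum semiring
  using (sum; ∑-distrib-+; *-distribˡ-sum; *-distribʳ-sum; sum-remove)
open import Algebra.Properties.Group ℚP.+-0-group using (x∙y⁻¹≈ε⇒x≈y; inverseʳ-unique)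
open +-*-Solver

p*q≡0⇒q≡0 : ∀ {p q} → p ≢ 0ℚ → p * q ≡ 0ℚ → q ≡ 0ℚ
p*q≡0⇒q≡0 {p} {q} p≢0 pq≡0 = begin
  q              ≡⟨ ℚP.*-identityˡ q ⟨
  1ℚ * q         ≡⟨ cong (_* q) (ℚP.*-inverseˡ p) ⟨
  1/ p * p * q   ≡⟨ ℚP.*-assoc (1/ p) p q ⟩
  1/ p * (p * q) ≡⟨ cong (1/ p *_) pq≡0 ⟩
  1/ p * 0ℚ      ≡⟨ ℚP.*-zeroʳ (1/ p) ⟩
  0ℚ             ∎
  where
  open ≡-Reasoning
  instance _ = ℚ.≢-nonZero p≢0

p*q≡0⇒p≡0 : ∀ {p q} → q ≢ 0ℚ → p * q ≡ 0ℚ → p ≡ 0ℚ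
p*q≡0⇒p≡0 {p} {q} q≢0 pq≡0 = p*q≡0⇒q≡0 q≢0 (trans (ℚP.*-comm q p) pq≡0)

+-pres-0≤ : ∀ {p q} → 0ℚ ≤ p → 0ℚ ≤ q → 0ℚ ≤ p + q
+-pres-0≤ 0≤p 0≤q = ℚP.+-mono-≤ 0≤p 0≤q

*-pres-0≤ : ∀ {p q} → 0ℚ ≤ p → 0ℚ ≤ q → 0ℚ ≤ p * q
*-pres-0≤ {p} {q} 0≤p 0≤q = ℚP.nonNegative⁻¹ (p * q)
  {{ℚP.nonNeg*nonNeg⇒nonNeg p {{ℚ.nonNegative 0≤p}} q {{ℚ.nonNegative 0≤q}}}}

0≤1 : 0ℚ ≤ 1ℚ
0≤1 = ℚP.≤ᵇ⇒≤ _

1≢0 : 1ℚ ≢ 0ℚ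
1≢0 ()

nonNeg-+-≡0ˡ : ∀ {p q} → 0ℚ ≤ p → 0ℚ ≤ q → p + q ≡ 0ℚ → p ≡ 0ℚ
nonNeg-+-≡0ˡ {p} {q} 0≤p 0≤q p+q≡0 = ℚP.≤-antisym p≤0 0≤p
  where
  p≤0 : p ≤ 0ℚ
  p≤0 = subst₂ _≤_ (ℚP.+-identityʳ p) p+q≡0 (ℚP.+-monoʳ-≤ p 0≤q)

nonNeg-+-≡0ʳ : ∀ {p q} → 0ℚ ≤ p → 0ℚ ≤ q → p + q ≡ 0ℚ → q ≡ 0ℚ
nonNeg-+-≡0ʳ {p} {q} 0≤p 0≤q p+q≡0 = nonNeg-+-≡0ˡ 0≤q 0≤p (trans (ℚP.+-comm q p) p+q≡0)

p*0≡0 : ∀ {p q} → q ≡ 0ℚ → p * q ≡ 0ℚ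
p*0≡0 {p} refl = ℚP.*-zeroʳ p

0*q≡0 : ∀ {p q} → p ≡ 0ℚ → p * q ≡ 0ℚ
0*q≡0 {q = q} refl = ℚP.*-zeroˡ q

Σℚ≡sum : ∀ {k} (f : Fin k → ℚ) → Σℚ f ≡ sum f
Σℚ≡sum {zero}  f = refl
Σℚ≡sum {suc k} f = cong (f zero +_) (Σℚ≡sum (f ∘ suc))

Σ-cong : ∀ {k} {f g : Fin k → ℚ} → (∀ l → f l ≡ g l) → Σℚ f ≡ Σℚ g
Σ-cong {zero}  f≗g = refl
Σ-cong {suc k} f≗g = cong₂ _+_ (f≗g zero) (Σ-cong (f≗g ∘ suc))

Σ-zero : ∀ {k} {f : Fin k → ℚ} → (∀ l → f l ≡ 0ℚ) → Σℚ f ≡ 0ℚ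
Σ-zero {zero}  f≗0 = refl
Σ-zero {suc k} f≗0 = trans (cong₂ _+_ (f≗0 zero) (Σ-zero (f≗0 ∘ suc))) (ℚP.+-identityˡ 0ℚ)

Σ-distrib-+ : ∀ {k} (f g : Fin k → ℚ) → Σℚ (λ l → f l + g l) ≡ Σℚ f + Σℚ g
Σ-distrib-+ f g = begin
  Σℚ (λ l → f l + g l) ≡⟨ Σℚ≡sum (λ l → f l + g l) ⟩
  sum (λ l → f l + g l) ≡⟨ ∑-distrib-+ f g ⟩
  sum f + sum g         ≡⟨ cong₂ _+_ (Σℚ≡sum f) (Σℚ≡sum g) ⟨
  Σℚ f + Σℚ g           ∎
  where open ≡-Reasoning

*-distribˡ-Σ : ∀ {k} (p : ℚ) (f : Fin k → ℚ) → p * Σℚ f ≡ Σℚ (λ l → p * f l)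
*-distribˡ-Σ p f = begin
  p * Σℚ f              ≡⟨ cong (p *_) (Σℚ≡sum f) ⟩
  p * sum f             ≡⟨ *-distribˡ-sum p f ⟩
  sum (λ l → p * f l)   ≡⟨ Σℚ≡sum (λ l → p * f l) ⟨
  Σℚ (λ l → p * f l)    ∎
  where open ≡-Reasoning

*-distribʳ-Σ : ∀ {k} (p : ℚ) (f : Fin k → ℚ) → Σℚ f * p ≡ Σℚ (λ l → f l * p)
*-distribʳ-Σ p f = begin
  Σℚ f * p              ≡⟨ cong (_* p) (Σℚ≡sum f) ⟩
  sum f * p             ≡⟨ *-distribʳ-sum p f ⟩
  sum (λ l → f l * p)   ≡⟨ Σℚ≡sum (λ l → f l * p) ⟨
  Σℚ (λ l → f l * p)    ∎
  where open ≡-Reasoning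

neg-distrib-Σ : ∀ {k} (f : Fin k → ℚ) → - Σℚ f ≡ Σℚ (λ l → - f l)
neg-distrib-Σ {zero}  f = refl
neg-distrib-Σ {suc k} f =
  trans (ℚP.neg-distrib-+ (f zero) (Σℚ (f ∘ suc))) (cong (- f zero +_) (neg-distrib-Σ (f ∘ suc)))

Σ-comm : ∀ {k m} (f : Fin k → Fin m → ℚ) →
         Σℚ (λ l → Σℚ (f l)) ≡ Σℚ (λ i → Σℚ (λ l → f l i))
Σ-comm {zero} {m} f = sym (Σ-zero {m} (λ _ → refl))
Σ-comm {suc k} f = trans (cong (Σℚ (f zero) +_) (Σ-comm (f ∘ suc)))
                         (sym (Σ-distrib-+ (f zero) (λ i → Σℚ (λ l → f (suc l) i))))

Σ-punchIn : ∀ {k} (p : Fin (suc k)) (f : Fin (suc k) → ℚ) →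
            Σℚ f ≡ f p + Σℚ (f ∘ punchIn p)
Σ-punchIn p f = begin
  Σℚ f                      ≡⟨ Σℚ≡sum f ⟩
  sum f                     ≡⟨ sum-remove f ⟩
  f p + sum (f ∘ punchIn p) ≡⟨ cong (f p +_) (Σℚ≡sum (f ∘ punchIn p)) ⟨
  f p + Σℚ (f ∘ punchIn p)  ∎
  where open ≡-Reasoning

Σ-pres-0≤ : ∀ {k} {f : Fin k → ℚ} → (∀ l → 0ℚ ≤ f l) → 0ℚ ≤ Σℚ f
Σ-pres-0≤ {zero}  0≤f = ℚP.≤-refl
Σ-pres-0≤ {suc k} 0≤f = +-pres-0≤ (0≤f zero) (Σ-pres-0≤ (0≤f ∘ suc))

nonNeg-Σ-≡0 : ∀ {k} {f : Fin k → ℚ} → (∀ l → 0ℚ ≤ f l) → Σℚ f ≡ 0ℚ → ∀ l → f l ≡ 0ℚ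
nonNeg-Σ-≡0 {suc k} 0≤f Σ≡0 zero    = nonNeg-+-≡0ˡ (0≤f zero) (Σ-pres-0≤ (0≤f ∘ suc)) Σ≡0
nonNeg-Σ-≡0 {suc k} 0≤f Σ≡0 (suc l) =
  nonNeg-Σ-≡0 (0≤f ∘ suc) (nonNeg-+-≡0ʳ (0≤f zero) (Σ-pres-0≤ (0≤f ∘ suc)) Σ≡0) l

δ : ∀ {k} → Fin k → Fin k → ℚ
δ p q with p FinP.≟ q
... | yes _ = 1ℚ
... | no  _ = 0ℚ

δ-diag : ∀ {k} (p : Fin k) → δ p p ≡ 1ℚ
δ-diag p with p FinP.≟ p
... | yes _   = refl
... | no  p≢p = ⊥-elim (p≢p refl)

δ-offdiag : ∀ {k} {p q : Fin k} → p ≢ q → δ p q ≡ 0ℚ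
δ-offdiag {p = p} {q} p≢q with p FinP.≟ q
... | yes p≡q = ⊥-elim (p≢q p≡q)
... | no  _   = refl

0≤δ : ∀ {k} (p q : Fin k) → 0ℚ ≤ δ p q
0≤δ p q with p FinP.≟ q
... | yes _ = 0≤1
... | no  _ = ℚP.≤-refl

Σ-δˡ : ∀ {k} (p : Fin k) (f : Fin k → ℚ) → Σℚ (λ q → δ p q * f q) ≡ f p
Σ-δˡ {suc k} p f = begin
  Σℚ (λ q → δ p q * f q)
    ≡⟨ Σ-punchIn p (λ q → δ p q * f q) ⟩
  δ p p * f p + Σℚ (λ m → δ p (punchIn p m) * f (punchIn p m))
    ≡⟨ cong₂ _+_ (cong (_* f p) (δ-diag p))
                 (Σ-zero (λ m → 0*q≡0 {q = f (punchIn p m)} (δ-offdiag (punchInᵢ≢i p m ∘ sym)))) ⟩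
  1ℚ * f p + 0ℚ
    ≡⟨ trans (ℚP.+-identityʳ _) (ℚP.*-identityˡ (f p)) ⟩
  f p ∎
  where open ≡-Reasoning

Σ-δʳ : ∀ {k} (p : Fin k) (f : Fin k → ℚ) → Σℚ (λ q → f q * δ q p) ≡ f p
Σ-δʳ {suc k} p f = begin
  Σℚ (λ q → f q * δ q p)
    ≡⟨ Σ-punchIn p (λ q → f q * δ q p) ⟩
  f p * δ p p + Σℚ (λ m → f (punchIn p m) * δ (punchIn p m) p)
    ≡⟨ cong₂ _+_ (cong (f p *_) (δ-diag p))
                 (Σ-zero (λ m → p*0≡0 {f (punchIn p m)} (δ-offdiag (punchInᵢ≢i p m)))) ⟩
  f p * 1ℚ + 0ℚ
    ≡⟨ trans (ℚP.+-identityʳ _) (ℚP.*-identityʳ (f p)) ⟩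
  f p ∎
  where open ≡-Reasoning

lincomb-congʳ : ∀ {d k} (g : Fin k → Vecℚ d) {c c′ : Fin k → ℚ} →
                (∀ l → c l ≡ c′ l) → lincomb g c ≈v lincomb g c′
lincomb-congʳ g c≗c′ i = Σ-cong (λ l → cong (_* g l i) (c≗c′ l))

lincomb-congˡ : ∀ {d k} {g h : Fin k → Vecℚ d} (c : Fin k → ℚ) →
                (∀ l → g l ≈v h l) → lincomb g c ≈v lincomb h c
lincomb-congˡ c g≈h i = Σ-cong (λ l → cong (c l *_) (g≈h l i))

lincomb-δ : ∀ {d k} (g : Fin k → Vecℚ d) (l : Fin k) → lincomb g (δ l) ≈v g l
lincomb-δ g l i = Σ-δˡ l (λ m → g m i)

lincomb-scale : ∀ {d k} (g : Fin k → Vecℚ d) (t : ℚ) (c : Fin k → ℚ) i →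
                lincomb g (λ l → t * c l) i ≡ t * lincomb g c i
lincomb-scale g t c i = trans (Σ-cong (λ l → ℚP.*-assoc t (c l) (g l i)))
                              (sym (*-distribˡ-Σ t (λ l → c l * g l i)))

lincomb-sub : ∀ {d k} (g : Fin k → Vecℚ d) (c c′ : Fin k → ℚ) i →
              lincomb g (λ l → c l - c′ l) i ≡ lincomb g c i - lincomb g c′ i
lincomb-sub g c c′ i = begin
  Σℚ (λ l → (c l - c′ l) * g l i)
    ≡⟨ Σ-cong (λ l → solve 3 (λ a b y → (a :- b) :* y := a :* y :+ (:- (b :* y))) refl
                              (c l) (c′ l) (g l i)) ⟩
  Σℚ (λ l → c l * g l i + - (c′ l * g l i))
    ≡⟨ Σ-distrib-+ (λ l → c l * g l i) (λ l → - (c′ l * g l i)) ⟩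
  lincomb g c i + Σℚ (λ l → - (c′ l * g l i))
    ≡⟨ cong (lincomb g c i +_) (neg-distrib-Σ (λ l → c′ l * g l i)) ⟨
  lincomb g c i - lincomb g c′ i ∎
  where open ≡-Reasoning

lincomb-injective : ∀ {d k} (g : Fin k → Vecℚ d) → LinIndep g → ∀ {c c′} →
                    lincomb g c ≈v lincomb g c′ → ∀ l → c l ≡ c′ l
lincomb-injective g indep {c} {c′} c≈c′ l = x∙y⁻¹≈ε⇒x≈y (c l) (c′ l) (indep (λ l → c l - c′ l) rel l)
  where
  rel : lincomb g (λ l → c l - c′ l) ≈v zeroV
  rel i = trans (lincomb-sub g c c′ i)
                (trans (cong (_- lincomb g c′ i) (c≈c′ i)) (ℚP.+-inverseʳ (lincomb g c′ i)))

LinIndep⇒nonzero : ∀ {d k} {g : Fin k → Vecℚ d} → LinIndep g → ∀ l → Nonzero (g l)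
LinIndep⇒nonzero {g = g} indep l gl≈0 =
  1≢0 (trans (sym (δ-diag l)) (indep (δ l) (λ i → trans (lincomb-δ g l i) (gl≈0 i)) l))

-- Gaussian elimination

Dependent : ∀ {d k} → (Fin k → Vecℚ d) → Set
Dependent g = ∃[ c ] (∃[ l ] c l ≢ 0ℚ) × lincomb g c ≈v zeroV

Dependent⇒¬LinIndep : ∀ {d k} {g : Fin k → Vecℚ d} → Dependent g → ¬ LinIndep g
Dependent⇒¬LinIndep (c , (l , cl≢0) , rel) indep = cl≢0 (indep c rel l)

-- Eliminates the first coordinate using the vector g p, whose first coordinate is nonzero.
module Pivot {d k : ℕ} (g : Fin (suc k) → Vecℚ (suc d)) (p : Fin (suc k))
             (gp₀≢0 : g p zero ≢ 0ℚ) where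

  instance
    gp₀-nonZero : ℚ.NonZero (g p zero)
    gp₀-nonZero = ℚ.≢-nonZero gp₀≢0

  ratio : Fin k → ℚ
  ratio m = g (punchIn p m) zero * 1/ g p zero

  reduced : Fin k → Vecℚ (suc d)
  reduced m i = g (punchIn p m) i - ratio m * g p i

  reduced-head≡0 : ∀ m → reduced m zero ≡ 0ℚ
  reduced-head≡0 m = begin
    x - x * 1/ g p zero * g p zero   ≡⟨ cong (λ y → x - y) (ℚP.*-assoc x (1/ g p zero) (g p zero)) ⟩
    x - x * (1/ g p zero * g p zero) ≡⟨ cong (λ y → x - x * y) (ℚP.*-inverseˡ (g p zero)) ⟩
    x - x * 1ℚ                       ≡⟨ cong (λ y → x - y) (ℚP.*-identityʳ x) ⟩
    x - x                            ≡⟨ ℚP.+-inverseʳ x ⟩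
    0ℚ                               ∎
    where
    open ≡-Reasoning
    x = g (punchIn p m) zero

  tail-reduced : Fin k → Vecℚ d
  tail-reduced m i = reduced m (suc i)

  pivot-coeff : (Fin (suc k) → ℚ) → ℚ
  pivot-coeff c = c p + Σℚ (λ m → c (punchIn p m) * ratio m)

  lincomb-reduced : ∀ c′ i → lincomb reduced c′ i ≡
                    lincomb (g ∘ punchIn p) c′ i - Σℚ (λ m → c′ m * ratio m) * g p i
  lincomb-reduced c′ i = begin
    Σℚ (λ m → c′ m * (g (punchIn p m) i - ratio m * g p i))
      ≡⟨ Σ-cong (λ m → solve 4 (λ c x r y → c :* (x :- r :* y) := c :* x :+ (:- (c :* r :* y))) refl
                                (c′ m) (g (punchIn p m) i) (ratio m) (g p i)) ⟩
    Σℚ (λ m → c′ m * g (punchIn p m) i + - (c′ m * ratio m * g p i))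
      ≡⟨ Σ-distrib-+ (λ m → c′ m * g (punchIn p m) i) (λ m → - (c′ m * ratio m * g p i)) ⟩
    lincomb (g ∘ punchIn p) c′ i + Σℚ (λ m → - (c′ m * ratio m * g p i))
      ≡⟨ cong (lincomb (g ∘ punchIn p) c′ i +_) (begin
           Σℚ (λ m → - (c′ m * ratio m * g p i))   ≡⟨ neg-distrib-Σ (λ m → c′ m * ratio m * g p i) ⟨
           - Σℚ (λ m → c′ m * ratio m * g p i)     ≡⟨ cong -_ (*-distribʳ-Σ (g p i) (λ m → c′ m * ratio m)) ⟨
           - (Σℚ (λ m → c′ m * ratio m) * g p i)   ∎) ⟩
    lincomb (g ∘ punchIn p) c′ i - Σℚ (λ m → c′ m * ratio m) * g p i ∎
    where open ≡-Reasoning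

  lincomb-split : ∀ c i → lincomb g c i ≡
                  pivot-coeff c * g p i + lincomb reduced (c ∘ punchIn p) i
  lincomb-split c i = begin
    lincomb g c i
      ≡⟨ Σ-punchIn p (λ l → c l * g l i) ⟩
    c p * g p i + s₁
      ≡⟨ solve 4 (λ a y s₁ s₂ → a :* y :+ s₁ := (a :+ s₂) :* y :+ (s₁ :- s₂ :* y)) refl
                 (c p) (g p i) s₁ s₂ ⟩
    pivot-coeff c * g p i + (s₁ - s₂ * g p i)
      ≡⟨ cong (pivot-coeff c * g p i +_) (lincomb-reduced (c ∘ punchIn p) i) ⟨
    pivot-coeff c * g p i + lincomb reduced (c ∘ punchIn p) i ∎
    where
    open ≡-Reasoning
    s₁ = lincomb (g ∘ punchIn p) (c ∘ punchIn p) i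
    s₂ = Σℚ (λ m → c (punchIn p m) * ratio m)

  lincomb-reduced-head : ∀ c′ → lincomb reduced c′ zero ≡ 0ℚ
  lincomb-reduced-head c′ = Σ-zero (λ m → p*0≡0 {c′ m} (reduced-head≡0 m))

  dependent : Dependent tail-reduced → Dependent g
  dependent (c′ , (m , c′m≢0) , rel) = c , (punchIn p m , c-punchIn≢0) , c-rel
    where
    c = insertAt c′ p (- Σℚ (λ m → c′ m * ratio m))
    c∘punchIn : ∀ m → c (punchIn p m) ≡ c′ m
    c∘punchIn = insertAt-punchIn c′ p (- Σℚ (λ m → c′ m * ratio m))
    c-punchIn≢0 : c (punchIn p m) ≢ 0ℚ
    c-punchIn≢0 = c′m≢0 ∘ trans (sym (c∘punchIn m))
    pivot-coeff≡0 : pivot-coeff c ≡ 0ℚ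
    pivot-coeff≡0 = trans (cong₂ _+_ (insertAt-lookup c′ p _)
                                     (Σ-cong (λ m → cong (_* ratio m) (c∘punchIn m))))
                          (ℚP.+-inverseˡ (Σℚ (λ m → c′ m * ratio m)))
    reduced-rel : lincomb reduced c′ ≈v zeroV
    reduced-rel zero    = lincomb-reduced-head c′
    reduced-rel (suc i) = rel i
    c-rel : lincomb g c ≈v zeroV
    c-rel i = begin
      lincomb g c i
        ≡⟨ lincomb-split c i ⟩
      pivot-coeff c * g p i + lincomb reduced (c ∘ punchIn p) i
        ≡⟨ cong₂ _+_ (0*q≡0 pivot-coeff≡0)
                     (trans (lincomb-congʳ reduced c∘punchIn i) (reduced-rel i)) ⟩
      0ℚ + 0ℚ
        ≡⟨ ℚP.+-identityˡ 0ℚ ⟩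
      0ℚ ∎
      where open ≡-Reasoning

  independent : LinIndep tail-reduced → LinIndep g
  independent indep c rel = c≡0
    where
    pivot-coeff≡0 : pivot-coeff c ≡ 0ℚ
    pivot-coeff≡0 = p*q≡0⇒p≡0 gp₀≢0 (begin
      pivot-coeff c * g p zero
        ≡⟨ ℚP.+-identityʳ _ ⟨
      pivot-coeff c * g p zero + 0ℚ
        ≡⟨ cong (pivot-coeff c * g p zero +_) (lincomb-reduced-head (c ∘ punchIn p)) ⟨
      pivot-coeff c * g p zero + lincomb reduced (c ∘ punchIn p) zero
        ≡⟨ lincomb-split c zero ⟨
      lincomb g c zero
        ≡⟨ rel zero ⟩
      0ℚ ∎)
      where open ≡-Reasoning
    c∘punchIn≡0 : ∀ m → c (punchIn p m) ≡ 0ℚ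
    c∘punchIn≡0 = indep (c ∘ punchIn p) λ i → begin
      lincomb reduced (c ∘ punchIn p) (suc i)
        ≡⟨ ℚP.+-identityˡ _ ⟨
      0ℚ + lincomb reduced (c ∘ punchIn p) (suc i)
        ≡⟨ cong (_+ lincomb reduced (c ∘ punchIn p) (suc i)) (0*q≡0 pivot-coeff≡0) ⟨
      pivot-coeff c * g p (suc i) + lincomb reduced (c ∘ punchIn p) (suc i)
        ≡⟨ lincomb-split c (suc i) ⟨
      lincomb g c (suc i)
        ≡⟨ rel (suc i) ⟩
      0ℚ ∎
      where open ≡-Reasoning
    c≡0 : ∀ l → c l ≡ 0ℚ
    c≡0 l with p FinP.≟ l
    ... | yes refl = trans (sym (ℚP.+-identityʳ (c p)))
                           (trans (cong (c p +_) (sym (Σ-zero (λ m → 0*q≡0 (c∘punchIn≡0 m)))))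
                                  pivot-coeff≡0)
    ... | no  p≢l  = trans (cong c (sym (FinP.punchIn-punchOut p≢l))) (c∘punchIn≡0 _)

dependent⊎independent : ∀ d k (g : Fin k → Vecℚ d) → Dependent g ⊎ (LinIndep g × k ℕ.≤ d)
dependent⊎independent d       zero    g = inj₂ ((λ _ _ ()) , z≤n)
dependent⊎independent zero    (suc k) g = inj₁ ((λ _ → 1ℚ) , (zero , 1≢0) , (λ ()))
dependent⊎independent (suc d) (suc k) g with any? (λ m → ¬? (g m zero ℚ.≟ 0ℚ))
... | yes (p , gp₀≢0) with dependent⊎independent d k (Pivot.tail-reduced g p gp₀≢0)
...   | inj₁ dep           = inj₁ (Pivot.dependent g p gp₀≢0 dep)
...   | inj₂ (indep , k≤d) = inj₂ (Pivot.independent g p gp₀≢0 indep , s≤s k≤d)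
dependent⊎independent (suc d) (suc k) g | no ∄pivot
  with dependent⊎independent d (suc k) (λ m → g m ∘ suc)
... | inj₁ (c , c≢0 , rel) = inj₁ (c , c≢0 , λ
        { zero    → Σ-zero (λ l → p*0≡0 {c l}
                      (decidable-stable (g l zero ℚ.≟ 0ℚ) (λ gl₀≢0 → ∄pivot (l , gl₀≢0))))
        ; (suc i) → rel i })
... | inj₂ (indep , k≤d)   = inj₂ ((λ c rel → indep c (rel ∘ suc)) , ℕP.m≤n⇒m≤1+n k≤d)

LinIndep? : ∀ {d k} (g : Fin k → Vecℚ d) → Dec (LinIndep g)
LinIndep? {d} {k} g with dependent⊎independent d k g
... | inj₁ dep         = no (Dependent⇒¬LinIndep dep)
... | inj₂ (indep , _) = yes indep

LinIndep⇒spanning : ∀ {d} {g : Fin d → Vecℚ d} → LinIndep g → ∀ x → ∃[ c ] lincomb g c ≈v x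
LinIndep⇒spanning {d} {g} indep x with dependent⊎independent d (suc d) (x ∷ g)
... | inj₂ (_ , d+1≤d) = ⊥-elim (ℕP.n≮n d d+1≤d)
... | inj₁ (c , (l , cl≢0) , rel) with c zero ℚ.≟ 0ℚ
...   | yes c₀≡0 = ⊥-elim (cl≢0 (c≡0 l))
  where
  c≡0 : ∀ l → c l ≡ 0ℚ
  c≡0 zero    = c₀≡0
  c≡0 (suc m) = indep (c ∘ suc) (λ i → trans (sym (ℚP.+-identityˡ _))
                  (trans (cong (_+ lincomb g (c ∘ suc) i) (sym (0*q≡0 c₀≡0))) (rel i))) m
...   | no c₀≢0 = (λ m → - (1/ c zero) * c (suc m)) , solution
  where
  instance _ = ℚ.≢-nonZero c₀≢0
  solution : lincomb g (λ m → - (1/ c zero) * c (suc m)) ≈v x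
  solution i = begin
    lincomb g (λ m → - (1/ c zero) * c (suc m)) i ≡⟨ lincomb-scale g (- (1/ c zero)) (c ∘ suc) i ⟩
    - (1/ c zero) * lincomb g (c ∘ suc) i         ≡⟨ cong (- (1/ c zero) *_) (inverseʳ-unique _ _ (rel i)) ⟩
    - (1/ c zero) * - (c zero * x i)
      ≡⟨ solve 3 (λ t a y → (:- t) :* (:- (a :* y)) := (t :* a) :* y) refl
                                                       (1/ c zero) (c zero) (x i) ⟩
    (1/ c zero * c zero) * x i                    ≡⟨ cong (_* x i) (ℚP.*-inverseˡ (c zero)) ⟩
    1ℚ * x i                                      ≡⟨ ℚP.*-identityˡ (x i) ⟩
    x i                                           ∎
    where open ≡-Reasoning

InPos? : ∀ {d} {g : Fin d → Vecℚ d} → LinIndep g → ∀ x → Dec (InPos g x)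
InPos? {g = g} indep x with LinIndep⇒spanning indep x
... | c , c-spec = map′ (λ 0≤c → c , 0≤c , c-spec) unique-coords (all? (λ l → 0ℚ ℚP.≤? c l))
  where
  unique-coords : InPos g x → Nonneg c
  unique-coords (c′ , 0≤c′ , c′-spec) l =
    subst (0ℚ ≤_) (lincomb-injective g indep {c′} {c} (λ i → trans (c′-spec i) (sym (c-spec i))) l) (0≤c′ l)

-- Deciding membership in σ(b)

any?-fun : ∀ {d n} {P : (Fin d → Fin n) → Set} →
           (∀ {s t} → s ≗ t → P s → P t) → (∀ s → Dec (P s)) → Dec (∃ P)
any?-fun {zero} resp P? =
  map′ (λ p → (λ ()) , resp (λ ()) p) (λ (s , p) → resp (λ ()) p) (P? (λ ()))
any?-fun {suc d} resp P? =
  map′ (λ (i , t , p) → i ∷ t , p) (λ (s , p) → s zero , s ∘ suc , resp s≗head∷tail p)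
       (any? λ i → any?-fun (λ t≗t′ → resp (cons-cong t≗t′)) (λ t → P? (i ∷ t)))
  where
  s≗head∷tail : ∀ {n} {s : Fin (suc d) → Fin n} → s ≗ s zero ∷ s ∘ suc
  s≗head∷tail zero    = refl
  s≗head∷tail (suc l) = refl
  cons-cong : ∀ {n} {i : Fin n} {t t′ : Fin d → Fin n} → t ≗ t′ → i ∷ t ≗ i ∷ t′
  cons-cong t≗t′ zero    = refl
  cons-cong t≗t′ (suc l) = t≗t′ l

injective? : ∀ {d n} (s : Fin d → Fin n) → Dec (Injective _≡_ _≡_ s)
injective? s = map′ (λ inj {x} {y} → inj x y) (λ inj x y → inj)
                    (all? λ x → all? λ y → (s x FinP.≟ s y) →-dec (x FinP.≟ y))

LinIndep-resp : ∀ {d k} {g h : Fin k → Vecℚ d} → (∀ l → g l ≈v h l) → LinIndep g → LinIndep h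
LinIndep-resp g≈h indep c rel = indep c (λ i → trans (lincomb-congˡ c g≈h i) (rel i))

InPos-resp : ∀ {d k} {g h : Fin k → Vecℚ d} {x} → (∀ l → g l ≈v h l) → InPos g x → InPos h x
InPos-resp g≈h (c , 0≤c , c-spec) = c , 0≤c , λ i → trans (sym (lincomb-congˡ c g≈h i)) (c-spec i)

cols-resp : ∀ {d n} (A : Matrix d n) {s t : Fin d → Fin n} → s ≗ t → ∀ l → col A (s l) ≈v col A (t l)
cols-resp A s≗t l i = cong (λ j → col A j i) (s≗t l)

BasisSel-resp : ∀ {d n} (A : Matrix d n) {s t} → s ≗ t → BasisSel A s → BasisSel A t
BasisSel-resp A {s} {t} s≗t (inj , indep) = inj′ , LinIndep-resp (cols-resp A s≗t) indep
  where
  inj′ : Injective _≡_ _≡_ t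
  inj′ {x} {y} tx≡ty = inj (trans (s≗t x) (trans tx≡ty (sym (s≗t y))))

BasisSel? : ∀ {d n} (A : Matrix d n) s → Dec (BasisSel A s)
BasisSel? A s = injective? s ×-dec LinIndep? (col A ∘ s)

Covers : ∀ {d n} → Matrix d n → Vecℚ d → (Fin d → Fin n) → Set
Covers A b s = BasisSel A s × InPos (col A ∘ s) b

Covers-resp : ∀ {d n} (A : Matrix d n) b {s t} → s ≗ t → Covers A b s → Covers A b t
Covers-resp A b s≗t (basis , b∈pos) = BasisSel-resp A s≗t basis , InPos-resp (cols-resp A s≗t) b∈pos

Covers? : ∀ {d n} (A : Matrix d n) b s → Dec (Covers A b s)
Covers? A b s with BasisSel? A s
... | yes basis = map′ (basis ,_) proj₂ (InPos? (proj₂ basis) b)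
... | no ¬basis = no (¬basis ∘ proj₁)

Separates : ∀ {d n} → Matrix d n → Vecℚ d → Vecℚ d → (Fin d → Fin n) → Set
Separates A b x s = Covers A b s × ¬ InPos (col A ∘ s) x

Separates? : ∀ {d n} (A : Matrix d n) b x s → Dec (Separates A b x s)
Separates? A b x s with Covers? A b s
... | yes cov = map′ (cov ,_) proj₂ (¬? (InPos? (proj₂ (proj₁ cov)) x))
... | no ¬cov = no (¬cov ∘ proj₁)

σ? : ∀ {d n} (A : Matrix d n) b x → Dec (σ A b x)
σ? A b x = map′ ∄separating⇒σ (λ x∈σ (s , (basis , b∈pos) , x∉pos) → x∉pos (x∈σ s basis b∈pos))
                (¬? (any?-fun Separates-resp (Separates? A b x)))
  where
  Separates-resp : ∀ {s t} → s ≗ t → Separates A b x s → Separates A b x t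
  Separates-resp s≗t (cov , x∉pos) = Covers-resp A b s≗t cov , x∉pos ∘ InPos-resp (cols-resp A (sym ∘ s≗t))
  ∄separating⇒σ : ¬ ∃ (Separates A b x) → σ A b x
  ∄separating⇒σ ∄sep s basis b∈pos =
    decidable-stable (InPos? (proj₂ basis) x) (λ x∉pos → ∄sep (s , (basis , b∈pos) , x∉pos))

ray-refl : ∀ {d} (v : Vecℚ d) → ray v v
ray-refl v = 1ℚ , 0≤1 , λ i → sym (ℚP.*-identityˡ (v i))

SameSet-sym : ∀ {d} {P Q : Cone d} → SameSet P Q → SameSet Q P
SameSet-sym P≡Q x = proj₂ (P≡Q x) , proj₁ (P≡Q x)

SameSet-trans : ∀ {d} {P Q R : Cone d} → SameSet P Q → SameSet Q R → SameSet P R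
SameSet-trans P≡Q Q≡R x = proj₁ (Q≡R x) ∘ proj₁ (P≡Q x) , proj₂ (P≡Q x) ∘ proj₂ (Q≡R x)

ray-multiple⇒SameSet : ∀ {d} {u v : Vecℚ d} → Nonzero u → ray v u → SameSet (ray u) (ray v)
ray-multiple⇒SameSet {u = u} {v} u≢0 (t , 0≤t , u≡tv) x with t ℚ.≟ 0ℚ
... | yes t≡0 = ⊥-elim (u≢0 (λ i → trans (u≡tv i) (0*q≡0 t≡0)))
... | no  t≢0 = to , from
  where
  instance _ = ℚ.≢-nonZero t≢0
  0≤1/t : 0ℚ ≤ 1/ t
  0≤1/t = ℚP.<⇒≤ (ℚP.positive⁻¹ _
            {{ℚP.1/pos⇒pos t {{ℚP.nonNeg∧nonZero⇒pos t {{ℚ.nonNegative 0≤t}}}}}})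
  to : ray u x → ray v x
  to (s , 0≤s , x≡su) = s * t , *-pres-0≤ 0≤s 0≤t ,
    λ i → trans (x≡su i) (trans (cong (s *_) (u≡tv i)) (sym (ℚP.*-assoc s t (v i))))
  from : ray v x → ray u x
  from (s , 0≤s , x≡sv) = s * 1/ t , *-pres-0≤ 0≤s 0≤1/t , λ i → trans (x≡sv i) (sym (begin
    s * 1/ t * u i         ≡⟨ cong (s * 1/ t *_) (u≡tv i) ⟩
    s * 1/ t * (t * v i)   ≡⟨ solve 4 (λ s r t y → s :* r :* (t :* y) := s :* (r :* t) :* y) refl
                                 s (1/ t) t (v i) ⟩
    s * (1/ t * t) * v i   ≡⟨ cong (λ r → s * r * v i) (ℚP.*-inverseˡ t) ⟩
    s * 1ℚ * v i           ≡⟨ cong (_* v i) (ℚP.*-identityʳ s) ⟩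
    s * v i                ∎))
    where open ≡-Reasoning

IsRay⇒ray⊆ : ∀ {d} {C : Cone d} {u x} → IsRay C u → ray u x → C x
IsRay⇒ray⊆ (_ , _ , _ , face , _) x∈ray = proj₁ (face _ x∈ray)

dot-congʳ : ∀ {d} (w : Vecℚ d) {x y} → x ≈v y → dot w x ≡ dot w y
dot-congʳ w x≈y = Σ-cong (λ i → cong (w i *_) (x≈y i))

dot-neg : ∀ {d} (w v : Vecℚ d) → dot w (λ i → - v i) ≡ - dot w v
dot-neg w v = trans (Σ-cong (λ i → sym (ℚP.neg-distribʳ-* (w i) (v i))))
                    (sym (neg-distrib-Σ (λ i → w i * v i)))

dot-lincomb : ∀ {d k} (w : Vecℚ d) (g : Fin k → Vecℚ d) (c : Fin k → ℚ) →
              dot w (lincomb g c) ≡ Σℚ (λ l → c l * dot w (g l))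
dot-lincomb w g c = begin
  Σℚ (λ i → w i * Σℚ (λ l → c l * g l i))   ≡⟨ Σ-cong (λ i → *-distribˡ-Σ (w i) (λ l → c l * g l i)) ⟩
  Σℚ (λ i → Σℚ (λ l → w i * (c l * g l i))) ≡⟨ Σ-comm (λ i l → w i * (c l * g l i)) ⟩
  Σℚ (λ l → Σℚ (λ i → w i * (c l * g l i))) ≡⟨ Σ-cong (λ l → trans (Σ-cong (λ i → swap (w i) (c l) (g l i)))
                                                              (sym (*-distribˡ-Σ (c l) (λ i → w i * g l i)))) ⟩
  Σℚ (λ l → c l * dot w (g l))              ∎
  where
  open ≡-Reasoning
  swap : ∀ x y z → x * (y * z) ≡ y * (x * z)
  swap = solve 3 (λ x y z → x :* (y :* z) := y :* (x :* z)) refl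

-- A cone containing a line has no rays; here the line is through v and -v.
full-cone-has-no-ray : ∀ {d} {C : Cone d} {v} → (∀ x → C x) → ¬ IsRay C v
full-cone-has-no-ray {v = v} C-full (v≢0 , w , _ , face , exposed) with exposed _ (C-full _) w·-v≡0
  where
  w·-v≡0 : dot w (λ i → - v i) ≡ 0ℚ
  w·-v≡0 = trans (dot-neg w v) (cong -_ (proj₂ (face v (ray-refl v))))
... | t , 0≤t , -v≡tv = v≢0 λ i → p*q≡0⇒q≡0 1+t≢0 (begin
  (1ℚ + t) * v i     ≡⟨ solve 2 (λ t y → (con 1ℚ :+ t) :* y := y :+ t :* y) refl t (v i) ⟩
  v i + t * v i      ≡⟨ cong (v i +_) (-v≡tv i) ⟨
  v i + - v i        ≡⟨ ℚP.+-inverseʳ (v i) ⟩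
  0ℚ                 ∎)
  where
  open ≡-Reasoning
  1+t≢0 : 1ℚ + t ≢ 0ℚ
  1+t≢0 1+t≡0 = ℚP.≤⇒≤ᵇ (subst₂ _≤_ (ℚP.+-identityʳ 1ℚ) 1+t≡0 (ℚP.+-monoʳ-≤ 1ℚ 0≤t))

SameSet-refl : ∀ {d} {P : Cone d} → SameSet P P
SameSet-refl x = (λ p → p) , (λ p → p)

InPos-ray-closed : ∀ {d k} (g : Fin k → Vecℚ d) {x y} → InPos g y → ray y x → InPos g x
InPos-ray-closed g (c , 0≤c , c-spec) (t , 0≤t , x≡ty) =
  (λ l → t * c l) , (λ l → *-pres-0≤ 0≤t (0≤c l)) ,
  λ i → trans (lincomb-scale g t c i) (trans (cong (t *_) (c-spec i)) (sym (x≡ty i)))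

σ-ray-closed : ∀ {d n} (A : Matrix d n) b {x y} → σ A b y → ray y x → σ A b x
σ-ray-closed A b y∈σ x∈ray s basis b∈pos = InPos-ray-closed (col A ∘ s) (y∈σ s basis b∈pos) x∈ray

ray-extreme : ∀ {d k} {C : Cone d} {v} (g : Fin k → Vecℚ d) (c : Fin k → ℚ) →
              IsRay C v → Nonneg c → lincomb g c ≈v v →
              (∀ l → c l ≢ 0ℚ → C (g l)) → ∀ l → c l ≢ 0ℚ → ray v (g l)
ray-extreme {v = v} g c (_ , w , supporting , face , exposed) 0≤c v≈ support l cl≢0 =
  exposed (g l) (support l cl≢0) (p*q≡0⇒q≡0 cl≢0 (nonNeg-Σ-≡0 0≤terms Σterms≡0 l))
  where
  0≤terms : ∀ l → 0ℚ ≤ c l * dot w (g l)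
  0≤terms l with c l ℚ.≟ 0ℚ
  ... | yes cl≡0  = ℚP.≤-reflexive (sym (0*q≡0 cl≡0))
  ... | no  cl≢0′ = *-pres-0≤ (0≤c l) (supporting (g l) (support l cl≢0′))
  Σterms≡0 : Σℚ (λ l → c l * dot w (g l)) ≡ 0ℚ
  Σterms≡0 = trans (sym (dot-lincomb w g c))
                   (trans (dot-congʳ w v≈) (proj₂ (face v (ray-refl v))))

-- Cones inside a simplicial cone

module Subcone {d} (a : Fin d → Vecℚ d) (indep : LinIndep a)
               (C : Cone d) (C⊆pos : ∀ {x} → C x → InPos a x) where

  coord : Vecℚ d → Fin d → ℚ
  coord x = proj₁ (LinIndep⇒spanning indep x)

  coord-spec : ∀ x → lincomb a (coord x) ≈v x
  coord-spec x = proj₂ (LinIndep⇒spanning indep x)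

  coord-unique : ∀ {x c} → lincomb a c ≈v x → ∀ m → coord x m ≡ c m
  coord-unique {x} c-spec = lincomb-injective a indep (λ i → trans (coord-spec x i) (sym (c-spec i)))

  coord-nonneg : ∀ {x} → C x → Nonneg (coord x)
  coord-nonneg x∈C with C⊆pos x∈C
  ... | c , 0≤c , c-spec = λ m → subst (0ℚ ≤_) (sym (coord-unique {c = c} c-spec m)) (0≤c m)

  -- δ i is the i-th standard unit vector.
  coord-linear : ∀ x m → coord x m ≡ Σℚ (λ i → x i * coord (δ i) m)
  coord-linear x = coord-unique λ j → begin
    Σℚ (λ m → Σℚ (λ i → x i * coord (δ i) m) * a m j)
      ≡⟨ Σ-cong (λ m → *-distribʳ-Σ (a m j) (λ i → x i * coord (δ i) m)) ⟩
    Σℚ (λ m → Σℚ (λ i → x i * coord (δ i) m * a m j))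
      ≡⟨ Σ-comm (λ m i → x i * coord (δ i) m * a m j) ⟩
    Σℚ (λ i → Σℚ (λ m → x i * coord (δ i) m * a m j))
      ≡⟨ Σ-cong (λ i → trans (Σ-cong (λ m → ℚP.*-assoc (x i) (coord (δ i) m) (a m j)))
                             (sym (*-distribˡ-Σ (x i) (λ m → coord (δ i) m * a m j)))) ⟩
    Σℚ (λ i → x i * lincomb a (coord (δ i)) j)
      ≡⟨ Σ-cong (λ i → cong (x i *_) (coord-spec (δ i) j)) ⟩
    Σℚ (λ i → x i * δ i j)
      ≡⟨ Σ-δʳ j x ⟩
    x j ∎
    where open ≡-Reasoning

  coord-functional : (ω : Fin d → ℚ) → ∃[ w ] ∀ x → dot w x ≡ Σℚ (λ m → ω m * coord x m)
  coord-functional ω = w , λ x → begin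
    Σℚ (λ i → Σℚ (λ m → ω m * coord (δ i) m) * x i)
      ≡⟨ Σ-cong (λ i → *-distribʳ-Σ (x i) (λ m → ω m * coord (δ i) m)) ⟩
    Σℚ (λ i → Σℚ (λ m → ω m * coord (δ i) m * x i))
      ≡⟨ Σ-comm (λ i m → ω m * coord (δ i) m * x i) ⟩
    Σℚ (λ m → Σℚ (λ i → ω m * coord (δ i) m * x i))
      ≡⟨ Σ-cong (λ m → trans (Σ-cong (λ i → rearrange (ω m) (coord (δ i) m) (x i)))
                             (sym (*-distribˡ-Σ (ω m) (λ i → x i * coord (δ i) m)))) ⟩
    Σℚ (λ m → ω m * Σℚ (λ i → x i * coord (δ i) m))
      ≡⟨ Σ-cong (λ m → cong (ω m *_) (coord-linear x m)) ⟨
    Σℚ (λ m → ω m * coord x m) ∎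
    where
    open ≡-Reasoning
    w : Vecℚ d
    w i = Σℚ (λ m → ω m * coord (δ i) m)
    rearrange : ∀ o e y → o * e * y ≡ o * (y * e)
    rearrange = solve 3 (λ o e y → o :* e :* y := o :* (y :* e)) refl

  -- The supporting functional of the face is the sum of all coordinates but the l-th.
  column-isRay : ∀ l → (∀ x → ray (a l) x → C x) → IsRay C (a l)
  column-isRay l ray⊆C = LinIndep⇒nonzero indep l , w , supporting , face , exposed
    where
    ω : Fin d → ℚ
    ω m with l FinP.≟ m
    ... | yes _ = 0ℚ
    ... | no  _ = 1ℚ

    0≤ω : ∀ m → 0ℚ ≤ ω m
    0≤ω m with l FinP.≟ m
    ... | yes _ = ℚP.≤-refl
    ... | no  _ = 0≤1

    ω*δ≡0 : ∀ m → ω m * δ l m ≡ 0ℚ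
    ω*δ≡0 m with l FinP.≟ m
    ... | yes _   = ℚP.*-zeroˡ 1ℚ
    ... | no  l≢m = ℚP.*-zeroʳ 1ℚ

    ω-off : ∀ {m} → l ≢ m → ω m ≢ 0ℚ
    ω-off {m} l≢m with l FinP.≟ m
    ... | yes l≡m = ⊥-elim (l≢m l≡m)
    ... | no  _   = 1≢0

    w : Vecℚ d
    w = proj₁ (coord-functional ω)

    dot-w : ∀ x → dot w x ≡ Σℚ (λ m → ω m * coord x m)
    dot-w = proj₂ (coord-functional ω)

    supporting : ∀ x → C x → 0ℚ ≤ dot w x
    supporting x x∈C = subst (0ℚ ≤_) (sym (dot-w x))
                             (Σ-pres-0≤ (λ m → *-pres-0≤ (0≤ω m) (coord-nonneg x∈C m)))

    face : ∀ x → ray (a l) x → C x × dot w x ≡ 0ℚ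
    face x x∈ray@(t , _ , x≡tal) = ray⊆C x x∈ray , (begin
      dot w x                            ≡⟨ dot-w x ⟩
      Σℚ (λ m → ω m * coord x m)         ≡⟨ Σ-cong (λ m → cong (ω m *_) (coord-on-axis m)) ⟩
      Σℚ (λ m → ω m * (t * δ l m))       ≡⟨ Σ-zero (λ m → on-axis (ω m) t (δ l m) (ω*δ≡0 m)) ⟩
      0ℚ                                 ∎)
      where
      open ≡-Reasoning
      x≈tδ : lincomb a (λ m → t * δ l m) ≈v x
      x≈tδ i = trans (lincomb-scale a t (δ l) i)
                     (trans (cong (t *_) (lincomb-δ a l i)) (sym (x≡tal i)))
      coord-on-axis : ∀ m → coord x m ≡ t * δ l m
      coord-on-axis = coord-unique {c = λ m → t * δ l m} x≈tδ
      on-axis : ∀ o t e → o * e ≡ 0ℚ → o * (t * e) ≡ 0ℚ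
      on-axis o t e oe≡0 = trans (solve 3 (λ o t e → o :* (t :* e) := t :* (o :* e)) refl o t e)
                                 (p*0≡0 {t} oe≡0)

    exposed : ∀ x → C x → dot w x ≡ 0ℚ → ray (a l) x
    exposed x x∈C w·x≡0 = coord x l , coord-nonneg x∈C l , λ i → begin
      x i                                   ≡⟨ coord-spec x i ⟨
      lincomb a (coord x) i                 ≡⟨ lincomb-congʳ a coord-on-axis i ⟩
      lincomb a (λ m → coord x l * δ l m) i ≡⟨ lincomb-scale a (coord x l) (δ l) i ⟩
      coord x l * lincomb a (δ l) i         ≡⟨ cong (coord x l *_) (lincomb-δ a l i) ⟩
      coord x l * a l i                     ∎
      where
      open ≡-Reasoning
      ω*coord≡0 : ∀ m → ω m * coord x m ≡ 0ℚ
      ω*coord≡0 = nonNeg-Σ-≡0 (λ m → *-pres-0≤ (0≤ω m) (coord-nonneg x∈C m))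
                               (trans (sym (dot-w x)) w·x≡0)
      coord-on-axis : ∀ m → coord x m ≡ coord x l * δ l m
      coord-on-axis m = by-cases (l FinP.≟ m)
        where
        by-cases : Dec (l ≡ m) → coord x m ≡ coord x l * δ l m
        by-cases (yes refl) = sym (trans (cong (coord x l *_) (δ-diag l)) (ℚP.*-identityʳ (coord x l)))
        by-cases (no l≢m)   = trans (p*q≡0⇒q≡0 (ω-off l≢m) (ω*coord≡0 m))
                                    (sym (p*0≡0 {coord x l} (δ-offdiag l≢m)))

lincomb-pushforward : ∀ {d k n} (g : Fin n → Vecℚ d) (s : Fin k → Fin n) (c : Fin k → ℚ) →
                      lincomb g (λ j → Σℚ (λ l → δ (s l) j * c l)) ≈v lincomb (g ∘ s) c
lincomb-pushforward g s c i = begin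
  Σℚ (λ j → Σℚ (λ l → δ (s l) j * c l) * g j i)
    ≡⟨ Σ-cong (λ j → *-distribʳ-Σ (g j i) (λ l → δ (s l) j * c l)) ⟩
  Σℚ (λ j → Σℚ (λ l → δ (s l) j * c l * g j i))
    ≡⟨ Σ-comm (λ j l → δ (s l) j * c l * g j i) ⟩
  Σℚ (λ l → Σℚ (λ j → δ (s l) j * c l * g j i))
    ≡⟨ Σ-cong (λ l → trans (Σ-cong (λ j → ℚP.*-assoc (δ (s l) j) (c l) (g j i)))
                           (Σ-δˡ (s l) (λ j → c l * g j i))) ⟩
  Σℚ (λ l → c l * g (s l) i) ∎
  where open ≡-Reasoning

external∈pos⇒selected : ∀ {d k n} (A : Matrix d n) (s : Fin k → Fin n) {j} →
                        External A j → InPos (col A ∘ s) (col A j) → ∃[ l ] s l ≡ j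
external∈pos⇒selected A s {j} ext (c , 0≤c , c-spec) with any? (λ l → s l FinP.≟ j)
... | yes selected = selected
... | no  ∄l       =
  ⊥-elim (ext (c′ , 0≤c′ , c′j≡0 , λ i → trans (lincomb-pushforward (col A) s c i) (c-spec i)))
  where
  c′ : Fin _ → ℚ
  c′ j′ = Σℚ (λ l → δ (s l) j′ * c l)
  0≤c′ : Nonneg c′
  0≤c′ j′ = Σ-pres-0≤ (λ l → *-pres-0≤ (0≤δ (s l) j′) (0≤c l))
  c′j≡0 : c′ j ≡ 0ℚ
  c′j≡0 = Σ-zero (λ l → 0*q≡0 {q = c l} (δ-offdiag (λ sl≡j → ∄l (l , sl≡j))))

record Enumeration {d} (P : Fin d → Set) : Set where
  field
    size              : ℕ
    elem              : Fin size → Fin d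
    elem-sat          : ∀ i → P (elem i)
    elem-complete     : ∀ l → P l → ∃[ i ] elem i ≡ l
    -- scatter μ puts μ i at position elem i and zeros elsewhere.
    scatter           : (Fin size → ℚ) → Fin d → ℚ
    Σ-scatter         : ∀ μ (f : Fin d → ℚ) →
                        Σℚ (λ i → μ i * f (elem i)) ≡ Σℚ (λ l → scatter μ l * f l)
    scatter-unsat     : ∀ μ {l} → ¬ P l → scatter μ l ≡ 0ℚ
    scatter-injective : ∀ μ → (∀ l → scatter μ l ≡ 0ℚ) → ∀ i → μ i ≡ 0ℚ

enumerate : ∀ {d} {P : Fin d → Set} → (∀ l → Dec (P l)) → Enumeration P
enumerate {zero} P? = record
  { size = 0 ; elem = λ () ; elem-sat = λ () ; elem-complete = λ ()
  ; scatter = λ _ () ; Σ-scatter = λ _ _ → refl ; scatter-unsat = λ _ {} ; scatter-injective = λ _ _ () }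
enumerate {suc d} {P} P? with P? zero | enumerate (P? ∘ suc)
... | yes p₀ | E = record
  { size = suc size ; elem = zero ∷ suc ∘ elem ; elem-sat = p₀ ∷ᵖ elem-sat ; elem-complete = complete
  ; scatter = λ μ → μ zero ∷ scatter (μ ∘ suc)
  ; Σ-scatter = λ μ f → cong (μ zero * f zero +_) (Σ-scatter (μ ∘ suc) (f ∘ suc))
  ; scatter-unsat = unsat
  ; scatter-injective = injective }
  where
  open Enumeration E
  _∷ᵖ_ : P zero → (∀ i → P (suc (elem i))) → ∀ i → P ((zero ∷ suc ∘ elem) i)
  (p ∷ᵖ ps) zero    = p
  (p ∷ᵖ ps) (suc i) = ps i
  complete : ∀ l → P l → ∃[ i ] (zero ∷ suc ∘ elem) i ≡ l
  complete zero    _  = zero , refl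
  complete (suc l) pl = let i , elem-i≡l = elem-complete l pl in suc i , cong suc elem-i≡l
  unsat : ∀ μ {l} → ¬ P l → (μ zero ∷ scatter (μ ∘ suc)) l ≡ 0ℚ
  unsat μ {zero}  ¬p₀ = ⊥-elim (¬p₀ p₀)
  unsat μ {suc l} ¬pl = scatter-unsat (μ ∘ suc) ¬pl
  injective : ∀ μ → (∀ l → (μ zero ∷ scatter (μ ∘ suc)) l ≡ 0ℚ) → ∀ i → μ i ≡ 0ℚ
  injective μ scatter≡0 zero    = scatter≡0 zero
  injective μ scatter≡0 (suc i) = scatter-injective (μ ∘ suc) (scatter≡0 ∘ suc) i
... | no ¬p₀ | E = record
  { size = size ; elem = suc ∘ elem ; elem-sat = elem-sat ; elem-complete = complete
  ; scatter = λ μ → 0ℚ ∷ scatter μ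
  ; Σ-scatter = λ μ f → trans (Σ-scatter μ (f ∘ suc))
                              (sym (trans (cong (_+ Σℚ (λ l → scatter μ l * f (suc l))) (ℚP.*-zeroˡ (f zero)))
                                          (ℚP.+-identityˡ (Σℚ (λ l → scatter μ l * f (suc l))))))
  ; scatter-unsat = unsat
  ; scatter-injective = λ μ scatter≡0 → scatter-injective μ (scatter≡0 ∘ suc) }
  where
  open Enumeration E
  complete : ∀ l → P l → ∃[ i ] suc (elem i) ≡ l
  complete zero    p₀ = ⊥-elim (¬p₀ p₀)
  complete (suc l) pl = let i , elem-i≡l = elem-complete l pl in i , cong suc elem-i≡l
  unsat : ∀ μ {l} → ¬ P l → (0ℚ ∷ scatter μ) l ≡ 0ℚ
  unsat μ {zero}  _   = refl
  unsat μ {suc l} ¬pl = scatter-unsat μ ¬pl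

module ExternalChamber {d n} (A : Matrix d n) (b : Vecℚ d) (v : Vecℚ d)
  (v-ray : IsRay (σ A b) v) (v-not-external : ¬ GenByExternal A v)
  (rays-classified : ∀ u → IsRay (σ A b) u → SameSet (ray u) (ray v) ⊎ GenByExternal A u)
  (s₀ : Fin d → Fin n) (s₀-covers : Covers A b s₀) where

  a : Fin d → Vecℚ d
  a = col A ∘ s₀

  a-indep : LinIndep a
  a-indep = proj₂ (proj₁ s₀-covers)

  C : Cone d
  C = σ A b

  C⊆pos : ∀ {x} → C x → InPos a x
  C⊆pos x∈C = x∈C s₀ (proj₁ s₀-covers) (proj₂ s₀-covers)

  open Subcone a a-indep C C⊆pos

  column-ray : ∀ l → C (a l) → IsRay C (a l)
  column-ray l al∈C = column-isRay l (λ x → σ-ray-closed A b al∈C)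

  ¬external-like-v : ∀ {u} → SameSet (ray u) (ray v) → ¬ GenByExternal A u
  ¬external-like-v u~v (j , ext , u~aj) =
    v-not-external (j , ext , SameSet-trans (SameSet-sym u~v) u~aj)

  ExternalColumn : Fin d → Set
  ExternalColumn l = C (a l) × GenByExternal A (a l)

  ExternalColumn? : ∀ l → Dec (ExternalColumn l)
  ExternalColumn? l = decide (σ? A b (a l))
    where
    classify : C (a l) → SameSet (ray (a l)) (ray v) ⊎ GenByExternal A (a l) → Dec (ExternalColumn l)
    classify al∈C (inj₁ al~v) = no (λ (_ , ext) → ¬external-like-v al~v ext)
    classify al∈C (inj₂ ext)  = yes (al∈C , ext)
    decide : Dec (C (a l)) → Dec (ExternalColumn l)
    decide (yes al∈C) = classify al∈C (rays-classified (a l) (column-ray l al∈C))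
    decide (no  al∉C) = no (λ (al∈C , _) → al∉C al∈C)

  open Enumeration (enumerate ExternalColumn?)

  generators : Fin (suc size) → Vecℚ d
  generators = v ∷ a ∘ elem

  generators-rays : ∀ l → IsRay C (generators l)
  generators-rays zero    = v-ray
  generators-rays (suc i) = column-ray (elem i) (proj₁ (elem-sat i))

  external-column-enumerated : ∀ {j} → External A j → C (col A j) → ∃[ i ] s₀ (elem i) ≡ j
  external-column-enumerated ext aj∈C =
    enumerated (external∈pos⇒selected A s₀ ext (C⊆pos aj∈C)) ext aj∈C
    where
    enumerated : ∀ {j} → ∃[ l ] s₀ l ≡ j → External A j → C (col A j) → ∃[ i ] s₀ (elem i) ≡ j
    enumerated (l , refl) ext al∈C = map₂ (cong s₀) (elem-complete l (al∈C , s₀ l , ext , SameSet-refl))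

  generators-complete : ∀ u → IsRay C u → ∃[ l ] SameSet (ray u) (ray (generators l))
  generators-complete u u-ray = classify (rays-classified u u-ray)
    where
    classify : SameSet (ray u) (ray v) ⊎ GenByExternal A u →
               ∃[ l ] SameSet (ray u) (ray (generators l))
    classify (inj₁ u~v)              = zero , u~v
    classify (inj₂ (j , ext , u~aj)) =
      suc (proj₁ enumerated) , subst (λ j′ → SameSet (ray u) (ray (col A j′))) (sym (proj₂ enumerated)) u~aj
      where
      enumerated : ∃[ i ] s₀ (elem i) ≡ j
      enumerated = external-column-enumerated ext
                     (IsRay⇒ray⊆ u-ray (proj₂ (u~aj (col A j)) (ray-refl (col A j))))

  c : Fin d → ℚ
  c = coord v

  v∈C : C v
  v∈C = IsRay⇒ray⊆ v-ray (ray-refl v)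

  c-nonzero : ∃[ l ] c l ≢ 0ℚ
  c-nonzero = decidable-stable (any? (λ l → ¬? (c l ℚ.≟ 0ℚ))) λ ∄l → proj₁ v-ray λ i →
    trans (sym (coord-spec v i))
          (Σ-zero (λ l → 0*q≡0 (decidable-stable (c l ℚ.≟ 0ℚ) (λ cl≢0 → ∄l (l , cl≢0)))))

  -- Otherwise v would be a positive combination of external rays of C, which by extremality
  -- of v would all lie on v.
  internal-support : ∃[ l ] ¬ ExternalColumn l × c l ≢ 0ℚ
  internal-support =
    decidable-stable (any? (λ l → ¬? (ExternalColumn? l) ×-dec ¬? (c l ℚ.≟ 0ℚ))) ¬¬internal
    where
    ¬¬internal : ¬ ¬ (∃[ l ] ¬ ExternalColumn l × c l ≢ 0ℚ)
    ¬¬internal ∄l = ¬external-like-v al~v (proj₂ (external l cl≢0))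
      where
      external : ∀ l → c l ≢ 0ℚ → ExternalColumn l
      external l cl≢0 = decidable-stable (ExternalColumn? l) (λ ¬ext → ∄l (l , ¬ext , cl≢0))
      l = proj₁ c-nonzero
      cl≢0 = proj₂ c-nonzero
      al~v : SameSet (ray (a l)) (ray v)
      al~v = ray-multiple⇒SameSet (LinIndep⇒nonzero a-indep l)
               (ray-extreme a c v-ray (coord-nonneg v∈C) (coord-spec v) (λ l → proj₁ ∘ external l) l cl≢0)

  generators-independent : LinIndep generators
  generators-independent κ rel = κ≡0
    where
    l₀ = proj₁ internal-support
    ¬ext₀ = proj₁ (proj₂ internal-support)
    cl₀≢0 = proj₂ (proj₂ internal-support)
    μ : Fin size → ℚ
    μ = κ ∘ suc
    γ : Fin d → ℚ
    γ l = κ zero * c l + scatter μ l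
    γ≡0 : ∀ l → γ l ≡ 0ℚ
    γ≡0 = a-indep γ λ j → begin
      Σℚ (λ l → (κ zero * c l + scatter μ l) * a l j)
        ≡⟨ Σ-cong (λ l → ℚP.*-distribʳ-+ (a l j) (κ zero * c l) (scatter μ l)) ⟩
      Σℚ (λ l → κ zero * c l * a l j + scatter μ l * a l j)
        ≡⟨ Σ-distrib-+ (λ l → κ zero * c l * a l j) (λ l → scatter μ l * a l j) ⟩
      lincomb a (λ l → κ zero * c l) j + Σℚ (λ l → scatter μ l * a l j)
        ≡⟨ cong₂ _+_ (trans (lincomb-scale a (κ zero) c j) (cong (κ zero *_) (coord-spec v j)))
                     (sym (Σ-scatter μ (λ l → a l j))) ⟩
      κ zero * v j + Σℚ (λ i → μ i * a (elem i) j)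
        ≡⟨ rel j ⟩
      0ℚ ∎
      where open ≡-Reasoning
    κ₀≡0 : κ zero ≡ 0ℚ
    κ₀≡0 = p*q≡0⇒p≡0 cl₀≢0 (begin
      κ zero * c l₀                  ≡⟨ ℚP.+-identityʳ _ ⟨
      κ zero * c l₀ + 0ℚ             ≡⟨ cong (κ zero * c l₀ +_) (scatter-unsat μ ¬ext₀) ⟨
      γ l₀                           ≡⟨ γ≡0 l₀ ⟩
      0ℚ                             ∎)
      where open ≡-Reasoning
    κ≡0 : ∀ l → κ l ≡ 0ℚ
    κ≡0 zero    = κ₀≡0
    κ≡0 (suc i) = scatter-injective μ (λ l → begin
      scatter μ l                    ≡⟨ ℚP.+-identityˡ _ ⟨
      0ℚ + scatter μ l               ≡⟨ cong (_+ scatter μ l) (0*q≡0 κ₀≡0) ⟨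
      γ l                            ≡⟨ γ≡0 l ⟩
      0ℚ                             ∎) i
      where open ≡-Reasoning

  simplicial : Simplicial C
  simplicial = suc size , generators , generators-rays , generators-complete , generators-independent

proposition3p9 : (d n : ℕ) (A : Matrix d n) → FullRank A → PointedKer A →
    (b : Vecℚ d) → IsChamber A b → ExternalCone A (σ A b) → Simplicial (σ A b)
proposition3p9 d n A _ _ b _ (v , v-ray , v-not-external , rays-classified)
  with any?-fun (Covers-resp A b) (Covers? A b)
... | yes (s₀ , s₀-covers) =
  ExternalChamber.simplicial A b v v-ray v-not-external rays-classified s₀ s₀-covers
... | no ∄cover =
  ⊥-elim (full-cone-has-no-ray (λ _ s basis b∈pos → ⊥-elim (∄cover (s , basis , b∈pos))) v-ray)
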